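{- Let $k \geq 3$. Over the Boolean domain $\{0,1\}$ the following strict inclusions hold: (1) $\mathrm{Inv}(e_2) \subsetneq \mathrm{Inv}(e_k)$; (2) $\mathrm{Inv}(n_k) \subsetneq \mathrm{Inv}(e_k) \subsetneq \mathrm{Inv}(u_k)$; (3) $\mathrm{Inv}(n_k) \subsetneq \mathrm{Inv}(n_{k+1})$; (4) $\mathrm{Inv}(e_k) \subsetneq \mathrm{Inv}(e_{k+1})$; (5) $\mathrm{Inv}(u_k) \subsetneq \mathrm{Inv}(u_{k+1})$.
   Context: A $k$-ary partial operation on a set $D$ is a map $f: X \to D$ with $X = \mathrm{dom}(f) \subseteq D^k$. For tuples $t_1,\dots,t_k \in D^n$, $f(t_1,\dots,t_k)$ is computed coordinatewise, and is defined iff $(t_1[i],\dots,t_k[i]) \in \mathrm{dom}(f)$ for every $i \in [n]$. A relation $R \subseteq D^n$ is preserved by $f$ (equivalently, $f$ is a partial polymorphism of $R$) if for all $t_1,\dots,t_k \in R$ such that $f(t_1,\dots,t_k)$ is defined, $f(t_1,\dots,t_k) \in R$. $\mathrm{Inv}(f)$ denotes the set of all finitary relations over $D$ preserved by $f$. Partial $k$-NU operation $n_k$ ($k \geq 3$): the $k$-ary partial operation whose domain consists exactly of the tuples $(x,\dots,x,y,x,\dots,x)$ ($y$ in a single arbitrary position $i\in[k]$, $x,y \in D$), mapped to $x$. Partial $k$-edge operation $e_k$ ($k \geq 2$): the $(k+1)$-ary partial operation whose domain consists exactly of the tuples $(x,x,y,y,\dots,y)$ and $(x,y,x,y,\dots,y)$,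 and, for each $i \in \{4,\dots,k+1\}$, the tuples $(y,\dots,y,x,y,\dots,y)$ with $x$ in position $i$ (for all $x,y\in D$), each mapped to $y$. $k$-universal operation $u_k$ ($k\ge 2$): the Boolean partial operation of arity $2^k-1$ whose arguments are indexed by the nonzero vectors $v \in \{0,1\}^k\setminus\{0^k\}$; for $j \in [k]$ let $s_j$ be the tuple with $s_j[v] = v[j]$. Its domain consists of the two constant tuples, the $k$ tuples $s_j$ and their complements $\overline{s_j}$; $u_k(c,\dots,c)=c$, $u_k(s_j)=0$, $u_k(\overline{s_j})=1$. -}

module Defs where

open import Data.Bool using (Bool; true; false; not; _∨_; T)
open import Data.Nat using (ℕ; zero; suc; _≤_)
open import Data.Fin using (Fin; zero; suc; toℕ)
open import Data.Vec using (Vec; []; _∷_; lookup)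
open import Data.Product using (Σ; ∃; ∃-syntax; _×_; _,_)
open import Data.Sum using (_⊎_)
open import Relation.Nullary using (¬_)
open import Relation.Binary.PropositionalEquality using (_≡_)
open import Data.Fin using (_≟_)
open import Relation.Nullary.Decidable using (⌊_⌋)
open import Data.Bool using (if_then_else_)

-- Boolean domain D = Bool.
-- A partial operation with arguments indexed by a type I (the arity) is
-- given by its graph: Graph t b holds iff t ∈ dom(f) and f(t) = b.
PartialOp : Set → Set₁
PartialOp I = (I → Bool) → Bool → Set

Rel : ℕ → Set₁
Rel n = (Fin n → Bool) → Set

Preserves : {I : Set} → PartialOp I → {n : ℕ} → Rel n → Set
Preserves {I} f {n} R =
  (ts : I → Fin n → Bool) → (∀ i → R (ts i)) →
  (out : Fin n → Bool) → (∀ j → f (λ i → ts i j) (out j)) → R out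

InvSub : {I J : Set} → PartialOp I → PartialOp J → Set₁
InvSub f g = (n : ℕ) (R : Rel n) → Preserves f R → Preserves g R

InvStrictSub : {I J : Set} → PartialOp I → PartialOp J → Set₁
InvStrictSub f g = InvSub f g × (∃[ n ] Σ (Rel n) λ R → Preserves g R × ¬ Preserves f R)

oneOff : {k : ℕ} → Fin k → Bool → Bool → Fin k → Bool
oneOff i x y j = if ⌊ j ≟ i ⌋ then y else x

nuOp : (k : ℕ) → PartialOp (Fin k)
nuOp k t b = ∃[ x ] ∃[ y ] ∃[ i ] ((∀ j → t j ≡ oneOff i x y j) × b ≡ x)

patA : {k : ℕ} → Bool → Bool → Fin k → Bool
patA x y zero = x
patA x y (suc zero) = x
patA x y (suc (suc j)) = y

patB : {k : ℕ} → Bool → Bool → Fin k → Bool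
patB x y zero = x
patB x y (suc zero) = y
patB x y (suc (suc zero)) = x
patB x y (suc (suc (suc j))) = y

-- positions i ∈ {4,...,k+1} (0-based Fin index ≥ 3)
Pos≥4 : {m : ℕ} → Fin m → Set
Pos≥4 i = 3 ≤ toℕ i

edgeOp : (k : ℕ) → PartialOp (Fin (suc k))
edgeOp k t b = ∃[ x ] ∃[ y ] (b ≡ y ×
  ((∀ j → t j ≡ patA x y j)
   ⊎ (∀ j → t j ≡ patB x y j)
   ⊎ (∃[ i ] (Pos≥4 i × (∀ j → t j ≡ oneOff i y x j)))))

nonzero : {k : ℕ} → Vec Bool k → Bool
nonzero [] = false
nonzero (b ∷ v) = b ∨ nonzero v

NZ : ℕ → Set
NZ k = Σ (Vec Bool k) (λ v → T (nonzero v))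

sTup : {k : ℕ} → Fin k → NZ k → Bool
sTup j (v , _) = lookup v j

univOp : (k : ℕ) → PartialOp (NZ k)
univOp k t b =
  (∃[ c ] ((∀ v → t v ≡ c) × b ≡ c))
  ⊎ (∃[ j ] ((∀ v → t v ≡ sTup j v) × b ≡ false))
  ⊎ (∃[ j ] ((∀ v → t v ≡ not (sTup j v)) × b ≡ true))

-- Inv(f) ⊆ Inv(g) whenever every defined value of g is a value of f on
-- reindexed arguments. Dropping the first argument of a defined tuple of e_k
-- gives a defined tuple of n_k; a defined tuple of u_k, read at the k+1 rows of
-- the matrix whose columns are the 0-valued domain tuples of e_k, is a defined
-- tuple of e_k; and dropping suitable arguments of n_{k+1}, e_{k+1}, u_{k+1}
-- gives the operation for k. For strictness, n_{k+1}, hence also e_{k+1} and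
-- u_{k+1}, preserves every k-ary relation: among k+1 rows one is missed by the
-- exceptional positions of all k columns, and that row is the output. So "not
-- all ones" separates n_k and u_k from their successors, and "non-constant",
-- which u_k also preserves, separates e_k from e_{k+1} and from u_k. Even parity
-- is preserved by e_k, whose values are x₁ ⊕ x₂ ⊕ x₃, but not by n_k; binary
-- NAND is preserved by n_3, hence by e_k, but not by e_2.
module Submission where

open import Defs
open import Algebra.Bundles using (CommutativeRing)
open import Data.Bool using (Bool; true; false; not; _xor_; T; if_then_else_)
import Data.Bool as Bool
open import Data.Bool.Properties
  using ( xor-∧-commutativeRing; xor-same; xor-comm; xor-identityʳ; xor-assoc
        ; if-eta; if-float; not-¬; ¬-not)
open import Algebra.Properties.CommutativeSemigroup
  (CommutativeRing.+-commutativeSemigroup xor-∧-commutativeRing) using (interchange)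
open import Data.Empty using (⊥)
open import Data.Fin using (Fin; zero; suc; _≟_; _↑ˡ_; punchIn)
open import Data.Fin.Properties
  using (pigeonhole; any?; all?; ¬∀⟶∃¬; <-irrefl; punchIn-punchOut)
open import Data.Nat using (ℕ; zero; suc; _+_; _≤_; _≤′_; ≤′-reflexive; ≤′-step; z≤n; s≤s)
open import Data.Nat.Properties using (≤⇒≤′; n<1+n; n≤1+n)
open import Data.Product using (∃; _×_; _,_; proj₁; proj₂)
open import Data.Sum using (inj₁; inj₂)
open import Data.Unit using (tt)
open import Data.Vec using (Vec; _∷_; lookup; tabulate; replicate)
open import Data.Vec.Functional using (foldr)
open import Data.Vec.Properties using (lookup∘tabulate; lookup-replicate)
open import Function using (_∘_; id)
open import Relation.Nullary using (¬_; yes; no; ¬?; contradiction)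
open import Relation.Nullary.Decidable using (⌊_⌋; ⌊⌋-map′; decidable-stable)
open import Relation.Binary.PropositionalEquality

private
  variable
    m n : ℕ

∃-notInImage : (f : Fin m → Fin (suc m)) → ∃ λ p → ∀ c → f c ≢ p
∃-notInImage {m} f =
  decidable-stable (any? λ p → all? λ c → ¬? (f c ≟ p)) (surjective⇒⊥ ∘ preimage)
  where
  preimage : ¬ (∃ λ p → ∀ c → f c ≢ p) → ∀ p → ∃ λ c → f c ≡ p
  preimage noMiss p =
    let c , ¬f[c]≢p = ¬∀⟶∃¬ m _ (λ c → ¬? (f c ≟ p)) (λ missed → noMiss (p , missed))
    in c , decidable-stable (f c ≟ p) ¬f[c]≢p

  surjective⇒⊥ : (∀ p → ∃ λ c → f c ≡ p) → ⊥
  surjective⇒⊥ g with pigeonhole (n<1+n m) (proj₁ ∘ g)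
  ... | i , j , i<j , same =
    <-irrefl (trans (sym (proj₂ (g i))) (trans (cong f same) (proj₂ (g j)))) i<j

oneOff-≢ : {i j : Fin n} {x y : Bool} → j ≢ i → oneOff i x y j ≡ x
oneOff-≢ {i = i} {j} j≢i with j ≟ i
... | yes j≡i = contradiction j≡i j≢i
... | no _ = refl

oneOff-self : (i : Fin n) {x y : Bool} → oneOff i x y i ≡ y
oneOff-self i with i ≟ i
... | yes _ = refl
... | no i≢i = contradiction refl i≢i

oneOff-suc : (i j : Fin n) {x y : Bool} → oneOff (suc i) x y (suc j) ≡ oneOff i x y j
oneOff-suc i j {x} {y} = cong (if_then y else x) (⌊⌋-map′ _ _ (j ≟ i))

oneOff-map : (f : Bool → Bool) (i j : Fin n) {x y : Bool} →
             f (oneOff i x y j) ≡ oneOff i (f x) (f y) j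
oneOff-map f i j = if-float f ⌊ j ≟ i ⌋

patA-map : (f : Bool → Bool) {x y : Bool} (p : Fin n) → f (patA x y p) ≡ patA (f x) (f y) p
patA-map f zero = refl
patA-map f (suc zero) = refl
patA-map f (suc (suc p)) = refl

patB-map : (f : Bool → Bool) {x y : Bool} (p : Fin n) → f (patB x y p) ≡ patB (f x) (f y) p
patB-map f zero = refl
patB-map f (suc zero) = refl
patB-map f (suc (suc zero)) = refl
patB-map f (suc (suc (suc p))) = refl

Pos≥4⇒suc³ : (i : Fin (3 + n)) → Pos≥4 i → ∃ λ j → i ≡ suc (suc (suc j))
Pos≥4⇒suc³ zero ()
Pos≥4⇒suc³ (suc zero) (s≤s ())
Pos≥4⇒suc³ (suc (suc zero)) (s≤s (s≤s ()))
Pos≥4⇒suc³ (suc (suc (suc j))) _ = j , refl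

pos≥4 : (j : Fin n) → Pos≥4 {3 + n} (suc (suc (suc j)))
pos≥4 _ = s≤s (s≤s (s≤s z≤n))

record _≼[_]_ {I J : Set} (g : PartialOp J) (σ : I → J) (f : PartialOp I) : Set where
  field reindex : ∀ {t b} → g t b → f (t ∘ σ) b

open _≼[_]_

≼⇒InvSub : {I J : Set} {f : PartialOp I} {g : PartialOp J} {σ : I → J} →
           g ≼[ σ ] f → InvSub f g
≼⇒InvSub {σ = σ} g≼f n R f-preserves ts rows out cols =
  f-preserves (ts ∘ σ) (rows ∘ σ) out (reindex g≼f ∘ cols)

InvSub-chain : {I : ℕ → Set} (f : (n : ℕ) → PartialOp (I n)) →
               (∀ n → InvSub (f n) (f (suc n))) → m ≤ n → InvSub (f m) (f n)
InvSub-chain f step = go ∘ ≤⇒≤′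
  where
  go : ∀ {m n} → m ≤′ n → InvSub (f m) (f n)
  go (≤′-reflexive refl) _ _ = id
  go (≤′-step m≤′n) n R = step _ n R ∘ go m≤′n n R

Extensional : Rel n → Set
Extensional R = ∀ {s t} → s ≗ t → R s → R t

Hits : (Fin n → Bool) → Bool → Set
Hits t b = ∃ λ i → t i ≡ b

Hits-ext : (b : Bool) → Extensional {n} (λ t → Hits t b)
Hits-ext b s≗t (i , s[i]≡b) = i , trans (sym (s≗t i)) s[i]≡b

NAND : (n : ℕ) → Rel n
NAND n t = Hits t false

NonConstant : (n : ℕ) → Rel n
NonConstant n t = ∀ b → Hits t b

NonConstant-ext : Extensional (NonConstant n)
NonConstant-ext s≗t hits b = Hits-ext b s≗t (hits b)

exception : {t : Fin n → Bool} {b : Bool} → nuOp n t b → Fin n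
exception (_ , _ , i , _) = i

nuOp-agrees : {t : Fin n → Bool} {b : Bool} (w : nuOp n t b) →
              ∀ j → exception w ≢ j → t j ≡ b
nuOp-agrees (_ , _ , i , t≗ , refl) j i≢j = trans (t≗ j) (oneOff-≢ (i≢j ∘ sym))

nuOp-preserves-Extensional : {R : Rel n} → Extensional R → Preserves (nuOp (suc n)) R
nuOp-preserves-Extensional R-ext ts rows out cols =
  let p , p∉ = ∃-notInImage (exception ∘ cols)
  in R-ext (λ c → nuOp-agrees (cols c) p (p∉ c)) (rows p)

nuOp-preserves-NAND : Preserves (nuOp (suc n)) (NAND n)
nuOp-preserves-NAND = nuOp-preserves-Extensional (Hits-ext false)

nuOp-step : nuOp (suc (suc n)) ≼[ suc ] nuOp (suc n)
nuOp-step .reindex (x , y , zero , t≗ , refl) =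
  x , x , zero , (λ p → trans (t≗ (suc p)) (sym (if-eta _))) , refl
nuOp-step .reindex (x , y , suc i , t≗ , refl) =
  x , y , i , (λ p → trans (t≗ (suc p)) (oneOff-suc i p)) , refl

Inv-nuOp-mono : m ≤ n → InvSub (nuOp (suc m)) (nuOp (suc n))
Inv-nuOp-mono = InvSub-chain (nuOp ∘ suc) (λ _ → ≼⇒InvSub nuOp-step)

edgeOp-≼-nuOp : edgeOp (2 + n) ≼[ suc ] nuOp (2 + n)
edgeOp-≼-nuOp .reindex (x , y , refl , inj₁ t≗) =
  y , x , zero , (λ { zero → t≗ (suc zero) ; (suc p) → t≗ (suc (suc p)) }) , refl
edgeOp-≼-nuOp .reindex (x , y , refl , inj₂ (inj₁ t≗)) =
  y , x , suc zero ,
  (λ { zero → t≗ (suc zero)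
     ; (suc zero) → t≗ (suc (suc zero))
     ; (suc (suc p)) → t≗ (suc (suc (suc p))) }) ,
  refl
edgeOp-≼-nuOp .reindex (x , y , refl , inj₂ (inj₂ (i , i≥4 , t≗))) with Pos≥4⇒suc³ i i≥4
... | j , refl =
  y , x , suc (suc j) , (λ p → trans (t≗ (suc p)) (oneOff-suc (suc (suc j)) p)) , refl

Inv-nuOp⊆Inv-edgeOp : InvSub (nuOp (2 + n)) (edgeOp (2 + n))
Inv-nuOp⊆Inv-edgeOp = ≼⇒InvSub edgeOp-≼-nuOp

edgeOp-step : edgeOp (3 + n) ≼[ punchIn (suc (suc (suc zero))) ] edgeOp (2 + n)
edgeOp-step .reindex (x , y , refl , inj₁ t≗) =
  x , y , refl , inj₁ λ { zero → t≗ _ ; (suc zero) → t≗ _ ; (suc (suc p)) → t≗ _ }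
edgeOp-step .reindex (x , y , refl , inj₂ (inj₁ t≗)) =
  x , y , refl , inj₂ (inj₁ λ
    { zero → t≗ _ ; (suc zero) → t≗ _ ; (suc (suc zero)) → t≗ _ ; (suc (suc (suc p))) → t≗ _ })
edgeOp-step .reindex (x , y , refl , inj₂ (inj₂ (i , i≥4 , t≗))) with Pos≥4⇒suc³ i i≥4
... | zero , refl =
  y , y , refl , inj₁ λ
    { zero → t≗ _ ; (suc zero) → t≗ _ ; (suc (suc zero)) → t≗ _ ; (suc (suc (suc p))) → t≗ _ }
... | suc j , refl =
  x , y , refl , inj₂ (inj₂ (suc (suc (suc j)) , pos≥4 j , λ
    { zero → t≗ _ ; (suc zero) → t≗ _ ; (suc (suc zero)) → t≗ _
    ; (suc (suc (suc p))) → trans (t≗ _) (oneOff-suc (suc (suc (suc j))) (suc (suc (suc p)))) }))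

Inv-edgeOp-mono : m ≤ n → InvSub (edgeOp (2 + m)) (edgeOp (2 + n))
Inv-edgeOp-mono = InvSub-chain (edgeOp ∘ (2 +_)) (λ _ → ≼⇒InvSub edgeOp-step)

minority : PartialOp (Fin 3)
minority t b = b ≡ t zero xor t (suc zero) xor t (suc (suc zero))

xor-cancelˡ : ∀ x y → x xor x xor y ≡ y
xor-cancelˡ x y = trans (sym (xor-assoc x x y)) (cong (_xor y) (xor-same x))

edgeOp-≼-minority : edgeOp (2 + n) ≼[ _↑ˡ n ] minority
edgeOp-≼-minority .reindex (x , y , refl , inj₁ t≗) =
  sym (trans (cong₂ _xor_ (t≗ _) (cong₂ _xor_ (t≗ _) (t≗ _))) (xor-cancelˡ x y))
edgeOp-≼-minority .reindex (x , y , refl , inj₂ (inj₁ t≗)) =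
  sym (trans (cong₂ _xor_ (t≗ _) (cong₂ _xor_ (t≗ _) (t≗ _)))
             (trans (cong (x xor_) (xor-comm y x)) (xor-cancelˡ x y)))
edgeOp-≼-minority .reindex (x , y , refl , inj₂ (inj₂ (i , i≥4 , t≗))) with Pos≥4⇒suc³ i i≥4
... | j , refl =
  sym (trans (cong₂ _xor_ (t≗ _) (cong₂ _xor_ (t≗ _) (t≗ _))) (xor-cancelˡ y y))

parity : (Fin n → Bool) → Bool
parity = foldr _xor_ false

Even : (n : ℕ) → Rel n
Even n t = parity t ≡ false

parity-cong : {s t : Fin n → Bool} → s ≗ t → parity s ≡ parity t
parity-cong {zero} _ = refl
parity-cong {suc n} s≗t = cong₂ _xor_ (s≗t zero) (parity-cong (s≗t ∘ suc))

parity-xor : (s t : Fin n → Bool) → parity (λ i → s i xor t i) ≡ parity s xor parity t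
parity-xor {zero} s t = refl
parity-xor {suc n} s t =
  trans (cong ((s zero xor t zero) xor_) (parity-xor (s ∘ suc) (t ∘ suc)))
        (interchange (s zero) (t zero) _ _)

parity-false : parity {n} (λ _ → false) ≡ false
parity-false {zero} = refl
parity-false {suc n} = parity-false {n}

parity-unit : (i : Fin n) → parity (λ j → ⌊ i ≟ j ⌋) ≡ true
parity-unit {suc n} zero = cong (true xor_) (parity-false {n})
parity-unit {suc n} (suc i) = trans (parity-cong (λ j → ⌊⌋-map′ _ _ (i ≟ j))) (parity-unit i)

minority-preserves-Even : Preserves minority (Even n)
minority-preserves-Even ts rows out cols = begin
  parity out
    ≡⟨ parity-cong cols ⟩
  parity (λ j → ts zero j xor ts (suc zero) j xor ts (suc (suc zero)) j)
    ≡⟨ parity-xor (ts zero) _ ⟩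
  parity (ts zero) xor parity (λ j → ts (suc zero) j xor ts (suc (suc zero)) j)
    ≡⟨ cong (parity (ts zero) xor_) (parity-xor (ts (suc zero)) (ts (suc (suc zero)))) ⟩
  parity (ts zero) xor parity (ts (suc zero)) xor parity (ts (suc (suc zero)))
    ≡⟨ cong₂ _xor_ (rows zero) (cong₂ _xor_ (rows (suc zero)) (rows (suc (suc zero)))) ⟩
  false ∎
  where open ≡-Reasoning

edgeOp-preserves-Even : Preserves (edgeOp (2 + n)) (Even m)
edgeOp-preserves-Even = ≼⇒InvSub edgeOp-≼-minority _ _ minority-preserves-Even

-- Row i is the unit vector e₀ with its i-th entry flipped, so every row is even,
-- every column is a near-unanimous tuple, and the output e₀ is odd.
nuOp-¬preserves-Even : ¬ Preserves (nuOp (suc n)) (Even (suc n))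
nuOp-¬preserves-Even {n} preserves =
  contradiction
    (preserves rows rows-even e₀ (λ j → e₀ j , not (e₀ j) , j , (λ _ → refl) , refl))
    (not-¬ {y = true} (parity-unit {suc n} zero))
  where
  e₀ : Fin (suc n) → Bool
  e₀ j = ⌊ zero ≟ j ⌋

  rows : Fin (suc n) → Fin (suc n) → Bool
  rows i j = oneOff j (e₀ j) (not (e₀ j)) i

  flip-as-xor : ∀ c a → (if c then not a else a) ≡ a xor c
  flip-as-xor false a = sym (xor-identityʳ a)
  flip-as-xor true a = sym (xor-comm a true)

  rows-even : ∀ i → Even (suc n) (rows i)
  rows-even i = begin
    parity (rows i)
      ≡⟨ parity-cong (λ j → flip-as-xor ⌊ i ≟ j ⌋ (e₀ j)) ⟩
    parity (λ j → e₀ j xor ⌊ i ≟ j ⌋)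
      ≡⟨ parity-xor e₀ (λ j → ⌊ i ≟ j ⌋) ⟩
    parity e₀ xor parity (λ j → ⌊ i ≟ j ⌋)
      ≡⟨ cong₂ _xor_ (parity-unit {suc n} zero) (parity-unit i) ⟩
    false ∎
    where open ≡-Reasoning

edgeOp₂-¬preserves-NAND₂ : ¬ Preserves (edgeOp 2) (NAND 2)
edgeOp₂-¬preserves-NAND₂ preserves =
  contradiction (proj₂ (preserves rows rows-NAND (λ _ → true) cols)) λ ()
  where
  rows : Fin 3 → Fin 2 → Bool
  rows p zero = patA false true p
  rows p (suc zero) = patB false true p

  rows-NAND : ∀ p → NAND 2 (rows p)
  rows-NAND zero = zero , refl
  rows-NAND (suc zero) = zero , refl
  rows-NAND (suc (suc zero)) = suc zero , refl

  cols : ∀ j → edgeOp 2 (λ p → rows p j) true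
  cols zero = false , true , refl , inj₁ λ _ → refl
  cols (suc zero) = false , true , refl , inj₂ (inj₁ λ _ → refl)

edgeOp-preserves-NAND₂ : Preserves (edgeOp (3 + n)) (NAND 2)
edgeOp-preserves-NAND₂ =
  Inv-nuOp⊆Inv-edgeOp _ _ (Inv-nuOp-mono (s≤s (s≤s z≤n)) _ _ nuOp-preserves-NAND)

edgeOp-preserves-NonConstant : Preserves (edgeOp (3 + n)) (NonConstant (2 + n))
edgeOp-preserves-NonConstant = Inv-nuOp⊆Inv-edgeOp _ _ (nuOp-preserves-Extensional NonConstant-ext)

-- The columns are the domain tuples of e_k with value 0.
edgeColumn : Fin (2 + n) → Fin (3 + n) → Bool
edgeColumn zero = patA true false
edgeColumn (suc zero) = patB true false
edgeColumn (suc (suc c)) = oneOff (suc (suc (suc c))) false true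

edgeColumn-edgeOp : (f : Bool → Bool) (c : Fin (2 + n)) {t : Fin (3 + n) → Bool} →
                    t ≗ f ∘ edgeColumn c → edgeOp (2 + n) t (f false)
edgeColumn-edgeOp f zero t≗ =
  f true , f false , refl , inj₁ (λ p → trans (t≗ p) (patA-map f p))
edgeColumn-edgeOp f (suc zero) t≗ =
  f true , f false , refl , inj₂ (inj₁ (λ p → trans (t≗ p) (patB-map f p)))
edgeColumn-edgeOp f (suc (suc c)) t≗ =
  f true , f false , refl , inj₂ (inj₂ (_ , pos≥4 c , λ p → trans (t≗ p) (oneOff-map f _ p)))

edgeColumn-true : (p : Fin (3 + n)) → Hits (λ c → edgeColumn c p) true
edgeColumn-true zero = zero , refl
edgeColumn-true (suc zero) = zero , refl
edgeColumn-true (suc (suc zero)) = suc zero , refl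
edgeColumn-true (suc (suc (suc q))) = suc (suc q) , oneOff-self (suc (suc (suc q)))

edgeColumn-false : (p : Fin (4 + n)) → Hits (λ c → edgeColumn c p) false
edgeColumn-false zero = suc (suc zero) , refl
edgeColumn-false (suc zero) = suc zero , refl
edgeColumn-false (suc (suc zero)) = zero , refl
edgeColumn-false (suc (suc (suc q))) = zero , refl

edgeOp-¬preserves-NonConstant : ¬ Preserves (edgeOp (3 + n)) (NonConstant (3 + n))
edgeOp-¬preserves-NonConstant preserves =
  contradiction (proj₂ (preserves rows rows-nonConstant (λ _ → false) cols true)) λ ()
  where
  rows : Fin (4 + n) → Fin (3 + n) → Bool
  rows p c = edgeColumn c p

  rows-nonConstant : ∀ p → NonConstant _ (rows p)
  rows-nonConstant p true = edgeColumn-true p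
  rows-nonConstant p false = edgeColumn-false p

  cols : ∀ c → edgeOp _ (λ p → rows p c) false
  cols c = edgeColumn-edgeOp id c λ _ → refl

true⇒nonzero : (v : Vec Bool n) (c : Fin n) → lookup v c ≡ true → T (nonzero v)
true⇒nonzero (true ∷ v) _ _ = tt
true⇒nonzero (false ∷ v) zero ()
true⇒nonzero (false ∷ v) (suc c) v[c]≡true = true⇒nonzero v c v[c]≡true

nonzero⇒true : (v : Vec Bool n) → T (nonzero v) → ∃ λ c → lookup v c ≡ true
nonzero⇒true (true ∷ v) _ = zero , refl
nonzero⇒true (false ∷ v) nz = let c , v[c]≡true = nonzero⇒true v nz in suc c , v[c]≡true

vecNZ : (v : Vec Bool n) → ∃ (λ c → lookup v c ≡ true) → NZ n
vecNZ v (c , v[c]≡true) = v , true⇒nonzero v c v[c]≡true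

edgeRow : Fin (3 + n) → NZ (2 + n)
edgeRow p =
  let c , row[c]≡true = edgeColumn-true p
  in vecNZ (tabulate row) (c , trans (lookup∘tabulate row c) row[c]≡true)
  where
  row : Fin _ → Bool
  row c = edgeColumn c p

sTup-edgeRow : (c : Fin (2 + n)) (p : Fin (3 + n)) → sTup c (edgeRow p) ≡ edgeColumn c p
sTup-edgeRow c p = lookup∘tabulate (λ c → edgeColumn c p) c

univOp-≼-edgeOp : univOp (2 + n) ≼[ edgeRow ] edgeOp (2 + n)
univOp-≼-edgeOp .reindex (inj₁ (c , t≗ , refl)) =
  edgeColumn-edgeOp (λ _ → c) zero (t≗ ∘ edgeRow)
univOp-≼-edgeOp .reindex (inj₂ (inj₁ (j , t≗ , refl))) =
  edgeColumn-edgeOp id j (λ p → trans (t≗ (edgeRow p)) (sTup-edgeRow j p))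
univOp-≼-edgeOp .reindex (inj₂ (inj₂ (j , t≗ , refl))) =
  edgeColumn-edgeOp not j (λ p → trans (t≗ (edgeRow p)) (cong not (sTup-edgeRow j p)))

Inv-edgeOp⊆Inv-univOp : InvSub (edgeOp (2 + n)) (univOp (2 + n))
Inv-edgeOp⊆Inv-univOp = ≼⇒InvSub univOp-≼-edgeOp

unitNZ : Fin n → NZ n
unitNZ i = vecNZ (tabulate unit) (i , trans (lookup∘tabulate unit i) (oneOff-self i))
  where
  unit : Fin _ → Bool
  unit c = oneOff c false true i

sTup-unitNZ : (j i : Fin n) → sTup j (unitNZ i) ≡ oneOff j false true i
sTup-unitNZ j i = lookup∘tabulate (λ c → oneOff c false true i) j

univOp-≼-nuOp : univOp (suc n) ≼[ unitNZ ] nuOp (suc n)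
univOp-≼-nuOp .reindex (inj₁ (c , t≗ , refl)) =
  c , c , zero , (λ i → trans (t≗ _) (sym (if-eta _))) , refl
univOp-≼-nuOp .reindex (inj₂ (inj₁ (j , t≗ , refl))) =
  false , true , j , (λ i → trans (t≗ _) (sTup-unitNZ j i)) , refl
univOp-≼-nuOp .reindex (inj₂ (inj₂ (j , t≗ , refl))) =
  true , false , j ,
  (λ i → trans (t≗ _) (trans (cong not (sTup-unitNZ j i)) (oneOff-map not j i))) , refl

univOp-preserves-NAND : Preserves (univOp (suc n)) (NAND n)
univOp-preserves-NAND = ≼⇒InvSub univOp-≼-nuOp _ _ nuOp-preserves-NAND

univOp-¬preserves-NAND : ¬ Preserves (univOp n) (NAND n)
univOp-¬preserves-NAND preserves =
  contradiction (proj₂ (preserves rows rows-NAND (λ _ → true) cols)) λ ()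
  where
  rows : NZ n → Fin n → Bool
  rows v c = not (sTup c v)

  rows-NAND : ∀ v → NAND _ (rows v)
  rows-NAND (v , nz) = let c , v[c]≡true = nonzero⇒true v nz in c , cong not v[c]≡true

  cols : ∀ c → univOp _ (λ v → rows v c) true
  cols c = inj₂ (inj₂ (c , (λ _ → refl) , refl))

nuOp-¬preserves-NAND : ¬ Preserves (nuOp (2 + n)) (NAND (2 + n))
nuOp-¬preserves-NAND =
  univOp-¬preserves-NAND ∘ Inv-edgeOp⊆Inv-univOp _ _ ∘ Inv-nuOp⊆Inv-edgeOp _ _

prependFalse : NZ n → NZ (suc n)
prependFalse (v , nz) = false ∷ v , nz

univOp-step : univOp (suc n) ≼[ prependFalse ] univOp n
univOp-step .reindex (inj₁ (c , t≗ , refl))               = inj₁ (c , t≗ ∘ prependFalse , refl)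
univOp-step .reindex (inj₂ (inj₁ (zero , t≗ , refl)))  = inj₁ (false , t≗ ∘ prependFalse , refl)
univOp-step .reindex (inj₂ (inj₁ (suc j , t≗ , refl))) = inj₂ (inj₁ (j , t≗ ∘ prependFalse , refl))
univOp-step .reindex (inj₂ (inj₂ (zero , t≗ , refl)))  = inj₁ (true , t≗ ∘ prependFalse , refl)
univOp-step .reindex (inj₂ (inj₂ (suc j , t≗ , refl))) = inj₂ (inj₂ (j , t≗ ∘ prependFalse , refl))

ones : NZ (suc n)
ones = replicate _ true , tt

univOp-constant-at-ones : {t : NZ (suc n) → Bool} {b : Bool} →
                          univOp (suc n) t b → t ones ≡ b → ∀ v → t v ≡ b
univOp-constant-at-ones (inj₁ (c , t≗ , refl)) _ = t≗
univOp-constant-at-ones (inj₂ (inj₁ (j , t≗ , refl))) t[ones]≡false =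
  contradiction (trans (sym (trans (t≗ ones) (lookup-replicate j true))) t[ones]≡false) λ ()
univOp-constant-at-ones (inj₂ (inj₂ (j , t≗ , refl))) t[ones]≡true =
  contradiction
    (trans (sym (trans (t≗ ones) (cong not (lookup-replicate j true)))) t[ones]≡true) λ ()

-- If the output were constant a, some column would agree with a on the row
-- indexed by ones and hence be constant; the other columns are near-unanimous on
-- the unit rows, and a unit row missed by all their exceptions would be constant.
univOp-preserves-NonConstant : Preserves (univOp (suc n)) (NonConstant (suc n))
univOp-preserves-NonConstant {n} ts rows out cols b =
  decidable-stable (any? λ c → out c Bool.≟ b) λ miss →
    constant-output⇒⊥ (λ c → ¬-not (miss ∘ (c ,_)))
  where
  constant-output⇒⊥ : ∀ {a} → (∀ c → out c ≡ a) → ⊥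
  constant-output⇒⊥ {a} out≡a = not-¬ (trans (row-j c) (out≡a c)) ts[j,c]≡not-a
    where
    c₀ : Fin (suc n)
    c₀ = proj₁ (rows ones a)

    column₀ : ∀ v → ts v c₀ ≡ out c₀
    column₀ = univOp-constant-at-ones (cols c₀) (trans (proj₂ (rows ones a)) (sym (out≡a c₀)))

    exceptionAt : Fin n → Fin (suc n)
    exceptionAt c′ = exception (reindex univOp-≼-nuOp (cols (punchIn c₀ c′)))

    j : Fin (suc n)
    j = proj₁ (∃-notInImage exceptionAt)

    row-j : ∀ c → ts (unitNZ j) c ≡ out c
    row-j c with c₀ ≟ c
    ... | yes refl = column₀ (unitNZ j)
    ... | no c₀≢c =
      subst (λ d → ts (unitNZ j) d ≡ out d) (punchIn-punchOut c₀≢c)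
            (nuOp-agrees (reindex univOp-≼-nuOp (cols _)) j (proj₂ (∃-notInImage exceptionAt) _))

    c : Fin (suc n)
    c = proj₁ (rows (unitNZ j) (not a))

    ts[j,c]≡not-a : ts (unitNZ j) c ≡ not a
    ts[j,c]≡not-a = proj₂ (rows (unitNZ j) (not a))

theorem9 : (k : ℕ) → 3 ≤ k →
    InvStrictSub (edgeOp 2) (edgeOp k)
    × (InvStrictSub (nuOp k) (edgeOp k) × InvStrictSub (edgeOp k) (univOp k))
    × InvStrictSub (nuOp k) (nuOp (suc k))
    × InvStrictSub (edgeOp k) (edgeOp (suc k))
    × InvStrictSub (univOp k) (univOp (suc k))
theorem9 k@(suc (suc (suc _))) (s≤s (s≤s (s≤s z≤n))) =
    (Inv-edgeOp-mono z≤n , 2 , NAND 2 , edgeOp-preserves-NAND₂ , edgeOp₂-¬preserves-NAND₂)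
  , ( (Inv-nuOp⊆Inv-edgeOp , k , Even k , edgeOp-preserves-Even , nuOp-¬preserves-Even)
    , (Inv-edgeOp⊆Inv-univOp , k , NonConstant k
      , univOp-preserves-NonConstant , edgeOp-¬preserves-NonConstant))
  , (Inv-nuOp-mono (n≤1+n _) , k , NAND k , nuOp-preserves-NAND , nuOp-¬preserves-NAND)
  , (Inv-edgeOp-mono (n≤1+n _) , k , NonConstant k
    , edgeOp-preserves-NonConstant , edgeOp-¬preserves-NonConstant)
  , (≼⇒InvSub univOp-step , k , NAND k , univOp-preserves-NAND , univOp-¬preserves-NAND)
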